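{- For $N\ge 0$ let $a_N$ be the number of tilings of the $5\times \tfrac{4N}{5}$ rectangle by $1\times 4$ tiles when $4N/5$ is a positive integer, $a_N=0$ when $4N/5$ is not an integer, and $a_0=1$. Then $$\sum_{N\ge 0} a_N z^N=\frac{(1-z^5)^3}{1-6z^5+6z^{10}-4z^{15}+z^{20}} = 1+3z^5+15z^{10}+75z^{15}+371z^{20}+\cdots.$$
   Context: A tiling of an $m\times n$ rectangle (made of $mn$ unit squares) by $a\times b$ tiles is a set of non-overlapping axis-parallel $a\times b$ or $b\times a$ rectangles with integer corners whose union is the rectangle; both orientations may be mixed. Tilings related by a symmetry of the rectangle are counted separately. The index $N$ is the number of tiles used. -}

module Defs where

open import Data.Nat using (ℕ; zero; suc; _+_; _*_; _≤_; _<_)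
open import Data.Nat.Divisibility using (_∣_)
open import Data.Fin using (Fin; toℕ)
import Data.Fin as Fin
import Data.List as List
open import Data.Bool using (Bool; true; false)
open import Data.Vec using (Vec; lookup)
open import Data.List using (List; length)
open import Data.List.Relation.Unary.Unique.Propositional using (Unique)
open import Data.List.Membership.Propositional using (_∈_)
open import Data.Product using (Σ; _×_; _,_)
open import Data.Integer as ℤ using (ℤ)
open import Relation.Binary.PropositionalEquality using (_≡_; _≢_)
open import Relation.Nullary using (¬_)

-- A placed tile is determined by its lower-left corner
-- (x , y) and an orientation o : Fin 2; orientation 0 means the tile
-- occupies [x, x+a) × [y, y+b), orientation 1 means [x, x+b) × [y, y+a).
-- (For a ≢ b these are the two distinct orientations; the theorem below
-- only uses a = 1, b = 4.)  The corner of any tile lying inside the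
-- rectangle is a cell, so it ranges over Fin m × Fin n.
--
-- A set of placed tiles is a subset of these placements, represented as
-- a Boolean vector (so that equality of tile sets is decidable and
-- extensional without function extensionality).

TileSet : ℕ → ℕ → Set
TileSet m n = Vec (Vec (Vec Bool 2) n) m

selected : ∀ {m n} → TileSet m n → Fin m → Fin n → Fin 2 → Set
selected S x y o = lookup (lookup (lookup S x) y) o ≡ true

width height : ℕ → ℕ → Fin 2 → ℕ
width  a b Fin.zero     = a
width  a b (Fin.suc _)  = b
height a b Fin.zero     = b
height a b (Fin.suc _)  = a

Fits : (m n a b : ℕ) → Fin m → Fin n → Fin 2 → Set
Fits m n a b x y o = (toℕ x + width a b o ≤ m) × (toℕ y + height a b o ≤ n)

Covers : (m n a b : ℕ) → Fin m → Fin n → Fin 2 → Fin m → Fin n → Set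
Covers m n a b x y o i j =
  (toℕ x ≤ toℕ i) × (toℕ i < toℕ x + width a b o) ×
  (toℕ y ≤ toℕ j) × (toℕ j < toℕ y + height a b o)

IsTiling : (m n a b : ℕ) → TileSet m n → Set
IsTiling m n a b S =
  (∀ x y o → selected S x y o → Fits m n a b x y o) ×
  (∀ i j → Σ (Fin m) λ x → Σ (Fin n) λ y → Σ (Fin 2) λ o →
       (selected S x y o × Covers m n a b x y o i j) ×
       (∀ x′ y′ o′ → selected S x′ y′ o′ → Covers m n a b x′ y′ o′ i j →
          (x′ ≡ x) × (y′ ≡ y) × (o′ ≡ o)))

HasCount : {A : Set} → (A → Set) → ℕ → Set
HasCount {A} P k = Σ (List A) λ L →
  Unique L × (∀ x → x ∈ L → P x) × (∀ x → P x → x ∈ L) × (length L ≡ k)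

NumTilings : (m n a b k : ℕ) → Set
NumTilings m n a b k = HasCount (IsTiling m n a b) k

-- The sequence a_N of the theorem, specified by its defining property:
--   a_0 = 1;
--   a_N = 0 if 4N/5 is not an integer, i.e. 5 ∤ N;
--   a_N = number of tilings of the 5 × (4N/5) rectangle by 1 × 4 tiles
--         if 4N/5 is a positive integer (N = 5k, k ≥ 1, 4N/5 = 4k).

IsSeqA : (ℕ → ℕ) → Set
IsSeqA a =
  (a 0 ≡ 1) ×
  (∀ N → ¬ (5 ∣ N) → a N ≡ 0) ×
  (∀ k → NumTilings 5 (4 * suc k) 1 4 (a (5 * suc k)))

Series : Set
Series = ℕ → ℤ

poly : List ℤ → Series
poly List.[]       _       = ℤ.0ℤ
poly (c List.∷ cs) zero    = c
poly (c List.∷ cs) (suc n) = poly cs n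

-- Σ_{i=0}^{n} f i (n - i), the Cauchy convolution
convolve : (ℕ → ℕ → ℤ) → ℕ → ℤ
convolve f zero    = f 0 0
convolve f (suc n) = f 0 (suc n) ℤ.+ convolve (λ i j → f (suc i) j) n

_⊛_ : Series → Series → Series
(f ⊛ g) n = convolve (λ i j → f i ℤ.* g j) n

zpow : ℕ → Series
zpow zero    = poly (ℤ.1ℤ List.∷ List.[])
zpow (suc k) = λ { zero → ℤ.0ℤ ; (suc n) → zpow k n }

one : Series
one = zpow 0

_⊕_ _⊖_ : Series → Series → Series
(f ⊕ g) n = f n ℤ.+ g n
(f ⊖ g) n = f n ℤ.- g n

_·_ : ℤ → Series → Series
(c · f) n = c ℤ.* f n

genSeries : (ℕ → ℕ) → Series
genSeries a N = ℤ.+ (a N)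

_≈ₛ_ : Series → Series → Set
f ≈ₛ g = ∀ n → f n ≡ g n

-- A row of the 5-wide strip holds at most one horizontal 1 × 4 tile, starting in column 0 or 1, and once
-- the horizontal tiles are fixed the vertical ones are forced.  Reading the rows upwards, each column only
-- has to remember how many cells of its current vertical tile are already placed, and columns 1–3 always
-- agree; so the tilings of the 5 × n rectangle correspond bijectively to the words of length n accepted by
-- a transfer automaton with 4³ states.  Since the number c(n, s) of words accepted from state s satisfies
-- c(n + 1, s) = Σ c(n, s′) over the successors s′, the recurrence
-- c(n + 16) − 6 c(n + 12) + 6 c(n + 8) − 4 c(n + 4) + c(n) = 0 holds for all n once it holds at n = 0 for
-- every state, which is a finite computation.  For a_N = c(4N/5) it says that the generating series times
-- 1 − 6z⁵ + 6z¹⁰ − 4z¹⁵ + z²⁰ has no coefficient beyond z¹⁹, and the first twenty are computed.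
module Submission where

open import Defs

module LinearRecurrence where

  open import Data.Nat using (ℕ; zero; suc; _+_; _*_; _≟_)
  open import Data.Nat.Properties using (+-comm; *-distribʳ-+)
  open import Data.Nat.Divisibility using (_∣_; divides; ∣m∣n⇒∣m+n; ∣-refl)
  open import Data.Nat.Solver using (module +-*-Solver)
  open import Data.Empty using (⊥-elim)
  open import Relation.Nullary using (¬_; Dec)
  open import Relation.Nullary.Decidable using (map′)
  open import Relation.Binary.PropositionalEquality using (_≡_; refl; sym; cong; cong₂; module ≡-Reasoning)

  -- The coefficients of 1 − 6X + 6X² − 4X³ + X⁴ annihilate u₀, …, u₄; both sides are moved so that
  -- no subtraction occurs.
  record Annihilated (u₀ u₁ u₂ u₃ u₄ : ℕ) : Set where
    constructor annihilated
    field equation : u₄ + 6 * u₂ + u₀ ≡ 6 * u₃ + 4 * u₁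

  annihilated? : ∀ u₀ u₁ u₂ u₃ u₄ → Dec (Annihilated u₀ u₁ u₂ u₃ u₄)
  annihilated? u₀ u₁ u₂ u₃ u₄ = map′ annihilated Annihilated.equation (_ ≟ _)

  Annihilated-+ : ∀ {u₀ u₁ u₂ u₃ u₄ v₀ v₁ v₂ v₃ v₄} →
    Annihilated u₀ u₁ u₂ u₃ u₄ → Annihilated v₀ v₁ v₂ v₃ v₄ →
    Annihilated (u₀ + v₀) (u₁ + v₁) (u₂ + v₂) (u₃ + v₃) (u₄ + v₄)
  Annihilated-+ {u₀} {u₁} {u₂} {u₃} {u₄} {v₀} {v₁} {v₂} {v₃} {v₄} (annihilated eu) (annihilated ev) =
    annihilated (begin
      (u₄ + v₄) + 6 * (u₂ + v₂) + (u₀ + v₀)  ≡⟨ split u₄ v₄ u₂ v₂ u₀ v₀ ⟩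
      (u₄ + 6 * u₂ + u₀) + (v₄ + 6 * v₂ + v₀) ≡⟨ cong₂ _+_ eu ev ⟩
      (6 * u₃ + 4 * u₁) + (6 * v₃ + 4 * v₁)  ≡⟨ merge u₃ v₃ u₁ v₁ ⟩
      6 * (u₃ + v₃) + 4 * (u₁ + v₁)          ∎)
    where
    open ≡-Reasoning
    open +-*-Solver
    split = solve 6 (λ a a′ b b′ c c′ → (a :+ a′) :+ con 6 :* (b :+ b′) :+ (c :+ c′)
                                     := (a :+ con 6 :* b :+ c) :+ (a′ :+ con 6 :* b′ :+ c′)) refl
    merge = solve 4 (λ e e′ h h′ → (con 6 :* e :+ con 4 :* h) :+ (con 6 :* e′ :+ con 4 :* h′)
                                 := con 6 :* (e :+ e′) :+ con 4 :* (h :+ h′)) refl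

  Recurrence : ℕ → (ℕ → ℕ) → Set
  Recurrence d f = ∀ q → Annihilated (f q) (f (d + q)) (f (2 * d + q)) (f (3 * d + q)) (f (4 * d + q))

  Annihilated-resp : ∀ {u₀ u₁ u₂ u₃ u₄ v₀ v₁ v₂ v₃ v₄} →
    u₀ ≡ v₀ → u₁ ≡ v₁ → u₂ ≡ v₂ → u₃ ≡ v₃ → u₄ ≡ v₄ →
    Annihilated u₀ u₁ u₂ u₃ u₄ → Annihilated v₀ v₁ v₂ v₃ v₄
  Annihilated-resp refl refl refl refl refl a = a

  recurrence-from-right : ∀ {d f} →
    (∀ q → Annihilated (f q) (f (q + d)) (f (q + 2 * d)) (f (q + 3 * d)) (f (q + 4 * d))) → Recurrence d f
  recurrence-from-right {d} {f} r q =
    Annihilated-resp refl (commute d) (commute (2 * d)) (commute (3 * d)) (commute (4 * d)) (r q)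
    where
    commute : ∀ k → f (q + k) ≡ f (k + q)
    commute k = cong f (+-comm q k)

  recurrence-subsample : ∀ {d f} → Recurrence d f → Recurrence 1 (λ q → f (q * d))
  recurrence-subsample {d} {f} r q = Annihilated-resp refl refl (distrib 2) (distrib 3) (distrib 4) (r (q * d))
    where
    distrib : ∀ k → f (k * d + q * d) ≡ f ((k + q) * d)
    distrib k = cong f (sym (*-distribʳ-+ d k q))

  -- stretch f is the coefficient sequence of F(z⁵), where f is that of F.
  stretch : (ℕ → ℕ) → ℕ → ℕ
  stretch f 0 = f 0
  stretch f 1 = 0
  stretch f 2 = 0
  stretch f 3 = 0
  stretch f 4 = 0
  stretch f (suc (suc (suc (suc (suc N))))) = stretch (λ q → f (suc q)) N

  stretch-*5 : ∀ f k → stretch f (k * 5) ≡ f k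
  stretch-*5 f zero    = refl
  stretch-*5 f (suc k) = stretch-*5 (λ q → f (suc q)) k

  stretch-∤ : ∀ f N → ¬ 5 ∣ N → stretch f N ≡ 0
  stretch-∤ f 0 5∤0 = ⊥-elim (5∤0 (divides 0 refl))
  stretch-∤ f 1 _   = refl
  stretch-∤ f 2 _   = refl
  stretch-∤ f 3 _   = refl
  stretch-∤ f 4 _   = refl
  stretch-∤ f (suc (suc (suc (suc (suc N))))) 5∤5+N =
    stretch-∤ (λ q → f (suc q)) N (λ 5∣N → 5∤5+N (∣m∣n⇒∣m+n ∣-refl 5∣N))

  stretch-recurrence : ∀ {f} → Recurrence 1 f → Recurrence 5 (stretch f)
  stretch-recurrence r 0 = r 0
  stretch-recurrence r 1 = annihilated refl
  stretch-recurrence r 2 = annihilated refl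
  stretch-recurrence r 3 = annihilated refl
  stretch-recurrence r 4 = annihilated refl
  stretch-recurrence r (suc (suc (suc (suc (suc m))))) = stretch-recurrence (λ q → r (suc q)) m

module TransferMatrix where

  open LinearRecurrence
    using (Annihilated; annihilated; annihilated?; Annihilated-+; Recurrence; recurrence-from-right)
  open import Data.Bool using (Bool; true; false; _∧_; if_then_else_)
  open import Data.Bool.Properties using (∧-conicalˡ; ∧-conicalʳ)
  open import Data.Nat using (ℕ; zero; suc; _+_; _≤_; _<_; _<ᵇ_; z≤n; s≤s)
  open import Data.Nat.Properties using (≤-refl)
  open import Data.List using (List; []; _∷_; [_]; _++_; map; length; cartesianProduct; cartesianProductWith)
  open import Data.List.Properties using (length-++; length-map)
  open import Data.List.Membership.Propositional using (_∈_)
  open import Data.List.Membership.Propositional.Properties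
    using (∈-map⁺; ∈-map⁻; ∈-++⁺ˡ; ∈-++⁺ʳ; ∈-++⁻; ∈-cartesianProductWith⁺; ∈-cartesianProduct⁺)
  open import Data.List.Relation.Unary.All as All using ()
  open import Data.List.Relation.Unary.Any using (here; there)
  open import Data.List.Relation.Unary.Unique.Propositional using (Unique; []; _∷_)
  import Data.List.Relation.Unary.Unique.Propositional.Properties as Unique
  open import Data.Vec using (Vec; []; _∷_)
  open import Data.Vec.Properties using (∷-injective; ∷-injectiveʳ)
  open import Data.Product using (∃; _×_; _,_; proj₁)
  open import Data.Sum using (inj₁; inj₂; [_,_]′)
  open import Function using (_⇔_; mk⇔)
  open import Relation.Nullary using (¬_; Dec; yes; no)
  open import Relation.Nullary.Decidable using (from-yes)
  open import Relation.Binary.PropositionalEquality using (_≡_; refl; sym; trans; cong; cong₂; subst)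

  -- Phase k of a column: k cells of the vertical tile currently being laid in it are placed.
  data Phase : Set where
    ph0 ph1 ph2 ph3 : Phase

  advance : Phase → Phase
  advance ph0 = ph1
  advance ph1 = ph2
  advance ph2 = ph3
  advance ph3 = ph0

  laid : Phase → ℕ
  laid ph0 = 0
  laid ph1 = 1
  laid ph2 = 2
  laid ph3 = 3

  isReady : Phase → Bool
  isReady ph0 = true
  isReady _   = false

  isReady⇒ph0 : ∀ {p} → isReady p ≡ true → p ≡ ph0
  isReady⇒ph0 {ph0} _ = refl

  laid<4 : ∀ p → laid p < 4
  laid<4 ph0 = s≤s z≤n
  laid<4 ph1 = s≤s (s≤s z≤n)
  laid<4 ph2 = s≤s (s≤s (s≤s z≤n))
  laid<4 ph3 = ≤-refl

  ready? : ∀ p → Dec (p ≡ ph0)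
  ready? ph0 = yes refl
  ready? ph1 = no (λ ())
  ready? ph2 = no (λ ())
  ready? ph3 = no (λ ())

  laid≡0⇒ph0 : ∀ {p} → laid p ≡ 0 → p ≡ ph0
  laid≡0⇒ph0 {ph0} _ = refl

  laid-advance : ∀ p → laid p < 3 → laid (advance p) ≡ suc (laid p)
  laid-advance ph0 _ = refl
  laid-advance ph1 _ = refl
  laid-advance ph2 _ = refl
  laid-advance ph3 (s≤s (s≤s (s≤s ())))

  data Row : Set where
    bar0 bar1 noBar : Row

  record State : Set where
    constructor state
    field
      col0 col123 col4 : Phase

  start : State
  start = state ph0 ph0 ph0

  isStart : State → Bool
  isStart (state p q r) = isReady p ∧ (isReady q ∧ isReady r)

  isStart⇒≡start : ∀ {s} → isStart s ≡ true → s ≡ start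
  isStart⇒≡start {state ph0 ph0 ph0} _ = refl

  -- Columns 1–3 share a phase, as every horizontal tile covers all three; columns ≥ 5 read as ph0.
  phaseAt : State → ℕ → Phase
  phaseAt (state p q r) 0 = p
  phaseAt (state p q r) 1 = q
  phaseAt (state p q r) 2 = q
  phaseAt (state p q r) 3 = q
  phaseAt (state p q r) 4 = r
  phaseAt _             _ = ph0

  covers : Row → ℕ → Bool
  covers bar0  x       = x <ᵇ 4
  covers bar1  zero    = false
  covers bar1  (suc x) = x <ᵇ 4
  covers noBar _       = false

  step : State → Row → State
  step (state p q r) bar0  = state p q (advance r)
  step (state p q r) bar1  = state (advance p) q r
  step (state p q r) noBar = state (advance p) (advance q) (advance r)

  allowed : State → Row → Bool
  allowed (state p q r) bar0  = isReady p ∧ isReady q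
  allowed (state p q r) bar1  = isReady q ∧ isReady r
  allowed (state p q r) noBar = true

  phaseAt-start : ∀ x → phaseAt start x ≡ ph0
  phaseAt-start 0 = refl
  phaseAt-start 1 = refl
  phaseAt-start 2 = refl
  phaseAt-start 3 = refl
  phaseAt-start 4 = refl
  phaseAt-start (suc (suc (suc (suc (suc _))))) = refl

  phaseAt-step : ∀ s ℓ x → x < 5 →
    phaseAt (step s ℓ) x ≡ (if covers ℓ x then phaseAt s x else advance (phaseAt s x))
  phaseAt-step _ bar0  0 _ = refl
  phaseAt-step _ bar0  1 _ = refl
  phaseAt-step _ bar0  2 _ = refl
  phaseAt-step _ bar0  3 _ = refl
  phaseAt-step _ bar0  4 _ = refl
  phaseAt-step _ bar1  0 _ = refl
  phaseAt-step _ bar1  1 _ = refl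
  phaseAt-step _ bar1  2 _ = refl
  phaseAt-step _ bar1  3 _ = refl
  phaseAt-step _ bar1  4 _ = refl
  phaseAt-step _ noBar 0 _ = refl
  phaseAt-step _ noBar 1 _ = refl
  phaseAt-step _ noBar 2 _ = refl
  phaseAt-step _ noBar 3 _ = refl
  phaseAt-step _ noBar 4 _ = refl
  phaseAt-step _ _ (suc (suc (suc (suc (suc _))))) (s≤s (s≤s (s≤s (s≤s (s≤s ())))))

  allowed⇒ready : ∀ s ℓ x → allowed s ℓ ≡ true → covers ℓ x ≡ true → phaseAt s x ≡ ph0
  allowed⇒ready _ bar0 0 ok _ = isReady⇒ph0 (∧-conicalˡ _ _ ok)
  allowed⇒ready _ bar0 1 ok _ = isReady⇒ph0 (∧-conicalʳ _ _ ok)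
  allowed⇒ready _ bar0 2 ok _ = isReady⇒ph0 (∧-conicalʳ _ _ ok)
  allowed⇒ready _ bar0 3 ok _ = isReady⇒ph0 (∧-conicalʳ _ _ ok)
  allowed⇒ready _ bar1 1 ok _ = isReady⇒ph0 (∧-conicalˡ _ _ ok)
  allowed⇒ready _ bar1 2 ok _ = isReady⇒ph0 (∧-conicalˡ _ _ ok)
  allowed⇒ready _ bar1 3 ok _ = isReady⇒ph0 (∧-conicalˡ _ _ ok)
  allowed⇒ready _ bar1 4 ok _ = isReady⇒ph0 (∧-conicalʳ _ _ ok)

  ready⇒allowed : ∀ s ℓ → (∀ x → x < 5 → covers ℓ x ≡ true → phaseAt s x ≡ ph0) → allowed s ℓ ≡ true
  ready⇒allowed (state p q r) bar0 ready
    with ready 0 (s≤s z≤n) refl | ready 1 (s≤s (s≤s z≤n)) refl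
  ... | refl | refl = refl
  ready⇒allowed (state p q r) bar1 ready
    with ready 1 (s≤s (s≤s z≤n)) refl | ready 4 (s≤s (s≤s (s≤s (s≤s (s≤s z≤n))))) refl
  ... | refl | refl = refl
  ready⇒allowed (state p q r) noBar _ = refl

  ready⇒start : ∀ s → (∀ x → x < 5 → phaseAt s x ≡ ph0) → s ≡ start
  ready⇒start (state p q r) ready
    with ready 0 (s≤s z≤n) | ready 1 (s≤s (s≤s z≤n)) | ready 4 (s≤s (s≤s (s≤s (s≤s (s≤s z≤n)))))
  ... | refl | refl | refl = refl

  rowAt : ∀ {n} → Vec Row n → ℕ → Row
  rowAt []      _       = noBar
  rowAt (ℓ ∷ w) zero    = ℓ
  rowAt (ℓ ∷ w) (suc y) = rowAt w y

  rowAt-≥ : ∀ {n} (w : Vec Row n) {y} → n ≤ y → rowAt w y ≡ noBar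
  rowAt-≥ []      _       = refl
  rowAt-≥ (ℓ ∷ w) (s≤s h) = rowAt-≥ w h

  tabulateℕ : (n : ℕ) → (ℕ → Row) → Vec Row n
  tabulateℕ zero    f = []
  tabulateℕ (suc n) f = f 0 ∷ tabulateℕ n (λ y → f (suc y))

  rowAt-tabulateℕ : ∀ n f {y} → y < n → rowAt (tabulateℕ n f) y ≡ f y
  rowAt-tabulateℕ (suc n) f {zero}  _       = refl
  rowAt-tabulateℕ (suc n) f {suc y} (s≤s h) = rowAt-tabulateℕ n (λ y → f (suc y)) h

  tabulateℕ-rowAt : ∀ n f (w : Vec Row n) → (∀ y → y < n → f y ≡ rowAt w y) → tabulateℕ n f ≡ w
  tabulateℕ-rowAt zero    f []      _ = refl
  tabulateℕ-rowAt (suc n) f (ℓ ∷ w) h =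
    cong₂ _∷_ (h 0 (s≤s z≤n))
      (tabulateℕ-rowAt n (λ y → f (suc y)) w (λ y y<n → h (suc y) (s≤s y<n)))

  run : ∀ {n} → State → Vec Row n → ℕ → State
  run s w zero    = s
  run s w (suc y) = step (run s w y) (rowAt w y)

  Accepts : ∀ {n} → State → Vec Row n → Set
  Accepts s []      = s ≡ start
  Accepts s (ℓ ∷ w) = allowed s ℓ ≡ true × Accepts (step s ℓ) w

  AcceptsStepwise : ∀ {n} → State → Vec Row n → Set
  AcceptsStepwise {n} s w = (∀ y → y < n → allowed (run s w y) (rowAt w y) ≡ true) × run s w n ≡ start

  run-∷ : ∀ {n} s ℓ (w : Vec Row n) y → run s (ℓ ∷ w) (suc y) ≡ run (step s ℓ) w y
  run-∷ s ℓ w zero    = refl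
  run-∷ s ℓ w (suc y) = cong (λ s′ → step s′ (rowAt w y)) (run-∷ s ℓ w y)

  accepts⇔stepwise : ∀ {n} s (w : Vec Row n) → Accepts s w ⇔ AcceptsStepwise s w
  accepts⇔stepwise s w = mk⇔ (to s w) (from s w)
    where
    to : ∀ {n} s (w : Vec Row n) → Accepts s w → AcceptsStepwise s w
    to s []      end              = (λ _ ()) , end
    to {suc n} s (ℓ ∷ w) (ok , accepts) with to (step s ℓ) w accepts
    ... | oks , end = oks′ , trans (run-∷ s ℓ w n) end
      where
      oks′ : ∀ y → y < suc n → allowed (run s (ℓ ∷ w) y) (rowAt (ℓ ∷ w) y) ≡ true
      oks′ zero    _       = ok
      oks′ (suc y) (s≤s y<) = subst (λ s′ → allowed s′ (rowAt w y) ≡ true) (sym (run-∷ s ℓ w y)) (oks y y<)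
    from : ∀ {n} s (w : Vec Row n) → AcceptsStepwise s w → Accepts s w
    from s []      (_ , end)   = end
    from {suc n} s (ℓ ∷ w) (oks , end) =
      oks 0 (s≤s z≤n) ,
      from (step s ℓ) w
        ( (λ y y< → subst (λ s′ → allowed s′ (rowAt w y) ≡ true) (run-∷ s ℓ w y) (oks (suc y) (s≤s y<)))
        , trans (sym (run-∷ s ℓ w n)) end)

  accepted : (n : ℕ) → State → List (Vec Row n)
  branch   : (n : ℕ) → State → Row → List (Vec Row (suc n))
  accepted zero    s = if isStart s then [ [] ] else []
  accepted (suc n) s = branch n s bar0 ++ (branch n s bar1 ++ branch n s noBar)
  branch n s ℓ = if allowed s ℓ then map (ℓ ∷_) (accepted n (step s ℓ)) else []

  count       : ℕ → State → ℕ
  branchCount : ℕ → State → Row → ℕ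
  count zero    s = if isStart s then 1 else 0
  count (suc n) s = branchCount n s bar0 + (branchCount n s bar1 + branchCount n s noBar)
  branchCount n s ℓ = if allowed s ℓ then count n (step s ℓ) else 0

  length-accepted : ∀ n s → length (accepted n s) ≡ count n s
  length-branch   : ∀ n s ℓ → length (branch n s ℓ) ≡ branchCount n s ℓ
  length-accepted zero s with isStart s
  ... | true  = refl
  ... | false = refl
  length-accepted (suc n) s =
    trans (length-++ (branch n s bar0))
      (cong₂ _+_ (length-branch n s bar0)
        (trans (length-++ (branch n s bar1)) (cong₂ _+_ (length-branch n s bar1) (length-branch n s noBar))))
  length-branch n s ℓ with allowed s ℓ
  ... | true  = trans (length-map (ℓ ∷_) (accepted n (step s ℓ))) (length-accepted n (step s ℓ))
  ... | false = refl

  ∈-branch⁻ : ∀ n s ℓ {v} → v ∈ branch n s ℓ →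
    ∃ λ w → v ≡ ℓ ∷ w × allowed s ℓ ≡ true × w ∈ accepted n (step s ℓ)
  ∈-branch⁻ n s ℓ m with allowed s ℓ
  ... | true with ∈-map⁻ (ℓ ∷_) m
  ...   | w , m′ , refl = w , refl , refl , m′

  ∈-accepted-suc⁻ : ∀ n s {v} → v ∈ accepted (suc n) s → ∃ λ ℓ → v ∈ branch n s ℓ
  ∈-accepted-suc⁻ n s m with ∈-++⁻ (branch n s bar0) m
  ... | inj₁ m₀ = bar0 , m₀
  ... | inj₂ m′ with ∈-++⁻ (branch n s bar1) m′
  ...   | inj₁ m₁ = bar1 , m₁
  ...   | inj₂ m₂ = noBar , m₂

  ∈-accepted⁻ : ∀ n s {w} → w ∈ accepted n s → Accepts s w
  ∈-accepted⁻ zero s m with isStart s in e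
  ∈-accepted⁻ zero s (here refl) | true = isStart⇒≡start e
  ∈-accepted⁻ (suc n) s m with ∈-accepted-suc⁻ n s m
  ... | ℓ , m′ with ∈-branch⁻ n s ℓ m′
  ...   | w , refl , ok , m″ = ok , ∈-accepted⁻ n (step s ℓ) m″

  ∈-accepted⁺ : ∀ {n} s (w : Vec Row n) → Accepts s w → w ∈ accepted n s
  ∈-accepted⁺ s []      refl = here refl
  ∈-accepted⁺ {suc n} s (ℓ ∷ w) (ok , accepts) = ∈-accepted-suc⁺ ℓ ∈branch
    where
    ∈branch : ℓ ∷ w ∈ branch n s ℓ
    ∈branch rewrite ok = ∈-map⁺ (ℓ ∷_) (∈-accepted⁺ (step s ℓ) w accepts)
    ∈-accepted-suc⁺ : ∀ ℓ′ → ℓ ∷ w ∈ branch n s ℓ′ → ℓ ∷ w ∈ accepted (suc n) s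
    ∈-accepted-suc⁺ bar0  m = ∈-++⁺ˡ m
    ∈-accepted-suc⁺ bar1  m = ∈-++⁺ʳ (branch n s bar0) (∈-++⁺ˡ m)
    ∈-accepted-suc⁺ noBar m = ∈-++⁺ʳ (branch n s bar0) (∈-++⁺ʳ (branch n s bar1) m)

  branches-disjoint : ∀ n s ℓ ℓ′ → ¬ ℓ ≡ ℓ′ → ∀ {v} → v ∈ branch n s ℓ → ¬ v ∈ branch n s ℓ′
  branches-disjoint n s ℓ ℓ′ ℓ≢ℓ′ m m′ with ∈-branch⁻ n s ℓ m | ∈-branch⁻ n s ℓ′ m′
  ... | _ , refl , _ | _ , eq , _ = ℓ≢ℓ′ (proj₁ (∷-injective eq))

  accepted-unique : ∀ n s → Unique (accepted n s)
  branch-unique   : ∀ n s ℓ → Unique (branch n s ℓ)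
  accepted-unique zero s with isStart s
  ... | true  = All.[] ∷ []
  ... | false = []
  accepted-unique (suc n) s =
    Unique.++⁺ (branch-unique n s bar0)
      (Unique.++⁺ (branch-unique n s bar1) (branch-unique n s noBar)
        (λ (m₁ , m₂) → branches-disjoint n s bar1 noBar (λ ()) m₁ m₂))
      (λ (m₀ , m) → [ branches-disjoint n s bar0 bar1 (λ ()) m₀ , branches-disjoint n s bar0 noBar (λ ()) m₀ ]′
                      (∈-++⁻ (branch n s bar1) m))
  branch-unique n s ℓ with allowed s ℓ
  ... | true  = Unique.map⁺ ∷-injectiveʳ (accepted-unique n (step s ℓ))
  ... | false = []

  phases : List Phase
  phases = ph0 ∷ ph1 ∷ ph2 ∷ ph3 ∷ []

  ∈-phases : ∀ p → p ∈ phases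
  ∈-phases ph0 = here refl
  ∈-phases ph1 = there (here refl)
  ∈-phases ph2 = there (there (here refl))
  ∈-phases ph3 = there (there (there (here refl)))

  uncurriedState : Phase → Phase × Phase → State
  uncurriedState p (q , r) = state p q r

  states : List State
  states = cartesianProductWith uncurriedState phases (cartesianProduct phases phases)

  ∈-states : ∀ s → s ∈ states
  ∈-states (state p q r) =
    ∈-cartesianProductWith⁺ uncurriedState (∈-phases p) (∈-cartesianProduct⁺ (∈-phases q) (∈-phases r))

  CountAnnihilated : ℕ → State → Set
  CountAnnihilated q s =
    Annihilated (count q s) (count (q + 4) s) (count (q + 8) s) (count (q + 12) s) (count (q + 16) s)

  -- The offsets sit on the right so that count (suc q + k) unfolds in one step; with k + suc q the
  -- conversion checker re-expands the whole tree of counts.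
  count-annihilated : ∀ q s → CountAnnihilated q s
  count-annihilated zero s =
    All.lookup (from-yes (All.all? {P = CountAnnihilated 0} (λ _ → annihilated? _ _ _ _ _) states)) (∈-states s)
  count-annihilated (suc q) s =
    Annihilated-+ (viaBranch bar0) (Annihilated-+ (viaBranch bar1) (viaBranch noBar))
    where
    viaBranch : ∀ ℓ → Annihilated (branchCount q s ℓ) (branchCount (q + 4) s ℓ) (branchCount (q + 8) s ℓ)
                                  (branchCount (q + 12) s ℓ) (branchCount (q + 16) s ℓ)
    viaBranch ℓ with allowed s ℓ
    ... | true  = count-annihilated q (step s ℓ)
    ... | false = annihilated refl

  count-recurrence : ∀ s → Recurrence 4 (λ n → count n s)
  count-recurrence s = recurrence-from-right {f = λ n → count n s} (λ q → count-annihilated q s)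

module Tilings where

  open TransferMatrix
  open import Data.Bool using (Bool; true; false; _∧_; not; if_then_else_)
  open import Data.Bool.Properties using (∧-conicalˡ; ∧-conicalʳ; not-involutive; T-≡)
  open import Data.Nat using (ℕ; zero; suc; _+_; _≤_; _<_; _<ᵇ_; NonZero; _≤?_; _<?_; z≤n; s≤s; z<s)
  open import Data.Nat.Base using (>-nonZero⁻¹)
  open import Data.Nat.Properties
    using (≤-refl; ≤-trans; <⇒≤; ≤-antisym; <-trans; <-irrefl; <-≤-trans; m≤m+n; m<m+n; n<1+n; n≤1+n;
           +-comm; +-suc; +-identityʳ; +-monoʳ-<; +-cancelˡ-<; +-cancelˡ-≡; +-cancelʳ-≡; m+n≤o⇒n≤o; 0≢1+n;
           m≤n⇒m<n∨m≡n; m≤n⇒∃[o]m+o≡n; m<1+n⇒m≤n; <ᵇ⇒<; <⇒<ᵇ; ≰⇒>; ≮⇒≥)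
  open import Data.Fin as Fin using (Fin; toℕ; fromℕ<)
  open import Data.Fin.Properties using (toℕ-fromℕ<; toℕ<n; toℕ-injective)
  open import Data.Vec using (Vec; []; _∷_; lookup; tabulate; replicate)
  open import Data.Vec.Properties using (lookup∘tabulate; tabulate∘lookup; tabulate-cong; lookup-replicate)
  open import Data.List using (List; map)
  open import Data.List.Properties using (length-map)
  open import Data.List.Membership.Propositional using (_∈_)
  open import Data.List.Membership.Propositional.Properties using (∈-map⁺; ∈-map⁻)
  open import Data.List.Relation.Unary.Unique.Propositional using (Unique)
  import Data.List.Relation.Unary.Unique.Propositional.Properties as Unique
  open import Data.Product using (Σ; ∃; _×_; _,_; proj₁; proj₂; uncurry)
  open import Data.Sum using (inj₁; inj₂)
  open import Data.Empty using (⊥; ⊥-elim)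
  open import Function using (Equivalence)
  open import Relation.Nullary using (yes; no)
  open import Relation.Binary.PropositionalEquality using (_≡_; _≢_; refl; sym; trans; cong; cong₂; subst)

  -- A 1 × 4 tile in orientation 0 occupies one column x and four rows y.
  pattern vertical   = Fin.zero
  pattern horizontal = Fin.suc Fin.zero

  -- Tile sets with ℕ coordinates, which are easier to compute with than the Fin-indexed TileSet.
  Placement : Set
  Placement = ℕ → ℕ → Fin 2 → Bool

  CoversCell : (a b : ℕ) → ℕ → ℕ → Fin 2 → ℕ → ℕ → Set
  CoversCell a b x y o i j = (x ≤ i) × (i < x + width a b o) × (y ≤ j) × (j < y + height a b o)

  IsTilingℕ : (m n a b : ℕ) → Placement → Set
  IsTilingℕ m n a b P =
    (∀ x y o → P x y o ≡ true → (x + width a b o ≤ m) × (y + height a b o ≤ n)) ×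
    (∀ i j → i < m → j < n → Σ ℕ λ x → Σ ℕ λ y → Σ (Fin 2) λ o →
       (P x y o ≡ true × CoversCell a b x y o i j) ×
       (∀ x′ y′ o′ → P x′ y′ o′ ≡ true → CoversCell a b x′ y′ o′ i j → (x′ ≡ x) × (y′ ≡ y) × (o′ ≡ o)))

  covers-unique : ∀ {m n a b P} → IsTilingℕ m n a b P → ∀ {i j x₁ y₁ o₁ x₂ y₂ o₂} → i < m → j < n →
    P x₁ y₁ o₁ ≡ true → CoversCell a b x₁ y₁ o₁ i j → P x₂ y₂ o₂ ≡ true → CoversCell a b x₂ y₂ o₂ i j →
    (x₁ ≡ x₂) × (y₁ ≡ y₂) × (o₁ ≡ o₂)
  covers-unique (_ , covered) {i} {j} i<m j<n sel₁ cov₁ sel₂ cov₂ with covered i j i<m j<n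
  ... | _ , _ , _ , _ , unique with unique _ _ _ sel₁ cov₁ | unique _ _ _ sel₂ cov₂
  ...   | refl , refl , refl | refl , refl , refl = refl , refl , refl

  asFin : ∀ {k x} → x < k → ∃ λ (f : Fin k) → toℕ f ≡ x
  asFin x<k = fromℕ< x<k , toℕ-fromℕ< x<k

  lookupOr : {A : Set} {k : ℕ} → A → Vec A k → ℕ → A
  lookupOr d []      _       = d
  lookupOr d (a ∷ v) zero    = a
  lookupOr d (a ∷ v) (suc i) = lookupOr d v i

  lookupOr-toℕ : {A : Set} {k : ℕ} (d : A) (v : Vec A k) (i : Fin k) → lookupOr d v (toℕ i) ≡ lookup v i
  lookupOr-toℕ d (a ∷ v) Fin.zero    = refl
  lookupOr-toℕ d (a ∷ v) (Fin.suc i) = lookupOr-toℕ d v i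

  lookupOr-≥ : {A : Set} {k : ℕ} (d : A) (v : Vec A k) {i : ℕ} → k ≤ i → lookupOr d v i ≡ d
  lookupOr-≥ d []      _       = refl
  lookupOr-≥ d (a ∷ v) (s≤s h) = lookupOr-≥ d v h

  lookupOr-replicate : {A : Set} (k : ℕ) (d : A) (i : ℕ) → lookupOr d (replicate k d) i ≡ d
  lookupOr-replicate zero    d i       = refl
  lookupOr-replicate (suc k) d zero    = refl
  lookupOr-replicate (suc k) d (suc i) = lookupOr-replicate k d i

  noTile : Vec Bool 2
  noTile = replicate 2 false

  toPlacement : ∀ {m n} → TileSet m n → Placement
  toPlacement {n = n} S x y o = lookup (lookupOr noTile (lookupOr (replicate n noTile) S x) y) o

  fromPlacement : ∀ {m n} → Placement → TileSet m n
  fromPlacement P = tabulate λ x → tabulate λ y → tabulate λ o → P (toℕ x) (toℕ y) o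

  toPlacement-toℕ : ∀ {m n} (S : TileSet m n) x y o →
    toPlacement S (toℕ x) (toℕ y) o ≡ lookup (lookup (lookup S x) y) o
  toPlacement-toℕ {n = n} S x y o
    rewrite lookupOr-toℕ (replicate n noTile) S x | lookupOr-toℕ noTile (lookup S x) y = refl

  toPlacement-≥ₓ : ∀ {m n} (S : TileSet m n) {x y} o → m ≤ x → toPlacement S x y o ≡ false
  toPlacement-≥ₓ {n = n} S {y = y} o m≤x =
    trans (cong (λ row → lookup (lookupOr noTile row y) o) (lookupOr-≥ (replicate n noTile) S m≤x))
          (trans (cong (λ v → lookup v o) (lookupOr-replicate n noTile y)) (lookup-replicate o false))

  toPlacement-≥ᵧ : ∀ {m n} (S : TileSet m n) {x y} o → n ≤ y → toPlacement S x y o ≡ false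
  toPlacement-≥ᵧ {n = n} S {x} o n≤y =
    trans (cong (λ v → lookup v o) (lookupOr-≥ noTile (lookupOr (replicate n noTile) S x) n≤y))
          (lookup-replicate o false)

  toPlacement-inside : ∀ {m n} (S : TileSet m n) {x y o} → toPlacement S x y o ≡ true → x < m × y < n
  toPlacement-inside {m} {n} S {x} {y} {o} sel with m ≤? x | n ≤? y
  ... | yes m≤x | _ with trans (sym (toPlacement-≥ₓ S o m≤x)) sel
  ...   | ()
  toPlacement-inside S sel | no _ | yes n≤y with trans (sym (toPlacement-≥ᵧ S _ n≤y)) sel
  ...   | ()
  toPlacement-inside S sel | no m≰x | no n≰y = ≰⇒> m≰x , ≰⇒> n≰y

  lookup-fromPlacement : ∀ {m n} P (x : Fin m) (y : Fin n) o →
    lookup (lookup (lookup (fromPlacement P) x) y) o ≡ P (toℕ x) (toℕ y) o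
  lookup-fromPlacement P x y o =
    trans (cong (λ row → lookup (lookup row y) o) (lookup∘tabulate _ x))
          (trans (cong (λ v → lookup v o) (lookup∘tabulate _ y)) (lookup∘tabulate (P (toℕ x) (toℕ y)) o))

  fromPlacement-toPlacement : ∀ {m n} (S : TileSet m n) → fromPlacement (toPlacement S) ≡ S
  fromPlacement-toPlacement S =
    trans (tabulate-cong λ x → tabulate-cong λ y → tabulate-cong λ o → toPlacement-toℕ S x y o)
          (trans (tabulate-cong λ x → trans (tabulate-cong λ y → tabulate∘lookup (lookup (lookup S x) y))
                                            (tabulate∘lookup (lookup S x)))
                 (tabulate∘lookup S))

  fromPlacement-cong : ∀ {m n} {P Q : Placement} → (∀ x y o → x < m → y < n → P x y o ≡ Q x y o) →
    fromPlacement {m} {n} P ≡ fromPlacement Q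
  fromPlacement-cong P≡Q =
    tabulate-cong λ x → tabulate-cong λ y → tabulate-cong λ o → P≡Q (toℕ x) (toℕ y) o (toℕ<n x) (toℕ<n y)

  IsTiling⇒IsTilingℕ : ∀ {m n a b} (S : TileSet m n) → IsTiling m n a b S → IsTilingℕ m n a b (toPlacement S)
  IsTiling⇒IsTilingℕ {m} {n} {a} {b} S (fits , covered) = fitsℕ , coveredℕ
    where
    selectedℕ : ∀ {x y o} → toPlacement S x y o ≡ true →
      ∃ λ (x′ : Fin m) → ∃ λ (y′ : Fin n) → toℕ x′ ≡ x × toℕ y′ ≡ y × selected S x′ y′ o
    selectedℕ sel with toPlacement-inside S sel
    ... | x<m , y<n with asFin x<m | asFin y<n
    ...   | x′ , refl | y′ , refl = x′ , y′ , refl , refl , trans (sym (toPlacement-toℕ S x′ y′ _)) sel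
    fitsℕ : ∀ x y o → toPlacement S x y o ≡ true → (x + width a b o ≤ m) × (y + height a b o ≤ n)
    fitsℕ x y o sel with selectedℕ sel
    ... | x′ , y′ , refl , refl , sel′ = fits x′ y′ o sel′
    coveredℕ : ∀ i j → i < m → j < n → Σ ℕ λ x → Σ ℕ λ y → Σ (Fin 2) λ o →
       (toPlacement S x y o ≡ true × CoversCell a b x y o i j) ×
       (∀ x′ y′ o′ → toPlacement S x′ y′ o′ ≡ true → CoversCell a b x′ y′ o′ i j →
          (x′ ≡ x) × (y′ ≡ y) × (o′ ≡ o))
    coveredℕ i j i<m j<n with asFin i<m | asFin j<n
    ... | i′ , refl | j′ , refl with covered i′ j′
    ...   | x , y , o , (sel , cov) , unique =
      toℕ x , toℕ y , o , (trans (toPlacement-toℕ S x y o) sel , cov) , uniqueℕ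
      where
      uniqueℕ : ∀ x′ y′ o′ → toPlacement S x′ y′ o′ ≡ true → CoversCell a b x′ y′ o′ (toℕ i′) (toℕ j′) →
        (x′ ≡ toℕ x) × (y′ ≡ toℕ y) × (o′ ≡ o)
      uniqueℕ _ _ o′ sel′ cov′ with selectedℕ sel′
      ... | x′ , y′ , refl , refl , sel″ with unique x′ y′ o′ sel″ cov′
      ...   | refl , refl , refl = refl , refl , refl

  IsTilingℕ⇒IsTiling : ∀ {m n a b} .{{_ : NonZero a}} .{{_ : NonZero b}} (P : Placement) →
    IsTilingℕ m n a b P → IsTiling m n a b (fromPlacement P)
  IsTilingℕ⇒IsTiling {m} {n} {a} {b} P (fitsℕ , coveredℕ) = fits , covered
    where
    extent-pos : ∀ o → 0 < width a b o × 0 < height a b o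
    extent-pos vertical   = >-nonZero⁻¹ a , >-nonZero⁻¹ b
    extent-pos horizontal = >-nonZero⁻¹ b , >-nonZero⁻¹ a
    selected⇒P : ∀ {x y o} → selected (fromPlacement P) x y o → P (toℕ x) (toℕ y) o ≡ true
    selected⇒P {x} {y} {o} sel = trans (sym (lookup-fromPlacement P x y o)) sel
    fits : ∀ x y o → selected (fromPlacement P) x y o → Fits m n a b x y o
    fits x y o sel = fitsℕ (toℕ x) (toℕ y) o (selected⇒P sel)
    covered : ∀ i j → Σ (Fin m) λ x → Σ (Fin n) λ y → Σ (Fin 2) λ o →
       (selected (fromPlacement P) x y o × Covers m n a b x y o i j) ×
       (∀ x′ y′ o′ → selected (fromPlacement P) x′ y′ o′ → Covers m n a b x′ y′ o′ i j →
          (x′ ≡ x) × (y′ ≡ y) × (o′ ≡ o))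
    covered i j with coveredℕ (toℕ i) (toℕ j) (toℕ<n i) (toℕ<n j)
    ... | x , y , o , (sel , cov) , unique with fitsℕ x y o sel
    ...   | x+w≤m , y+h≤n with asFin (≤-trans (m<m+n x (extent-pos o .proj₁)) x+w≤m)
                             | asFin (≤-trans (m<m+n y (extent-pos o .proj₂)) y+h≤n)
    ...     | x′ , refl | y′ , refl =
      x′ , y′ , o , (trans (lookup-fromPlacement P x′ y′ o) sel , cov) , unique′
      where
      unique′ : ∀ x″ y″ o″ → selected (fromPlacement P) x″ y″ o″ → Covers m n a b x″ y″ o″ i j →
        (x″ ≡ x′) × (y″ ≡ y′) × (o″ ≡ o)
      unique′ x″ y″ o″ sel′ cov′ with unique (toℕ x″) (toℕ y″) o″ (selected⇒P sel′) cov′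
      ... | x≡ , y≡ , refl = toℕ-injective x≡ , toℕ-injective y≡ , refl

  <ᵇ-true⇒< : ∀ {m n} → (m <ᵇ n) ≡ true → m < n
  <ᵇ-true⇒< {m} {n} e = <ᵇ⇒< m n (Equivalence.from T-≡ e)

  <⇒<ᵇ-true : ∀ {m n} → m < n → (m <ᵇ n) ≡ true
  <⇒<ᵇ-true m<n = Equivalence.to T-≡ (<⇒<ᵇ m<n)

  within⇒offset : ∀ {y j k} → y ≤ j → j < y + k → ∃ λ d → d < k × y + d ≡ j
  within⇒offset {y} y≤j j<y+k with m≤n⇒∃[o]m+o≡n y≤j
  ... | d , refl = d , +-cancelˡ-< y _ _ j<y+k , refl

  offset⇒within : ∀ {y₀ d y k} → d < k → y₀ + d ≡ y → y₀ ≤ y × y < y₀ + k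
  offset⇒within {y₀} d<k refl = m≤m+n y₀ _ , +-monoʳ-< y₀ d<k

  within₁⇒≡ : ∀ {x i} → x ≤ i → i < x + 1 → x ≡ i
  within₁⇒≡ {x} {i} x≤i i<x+1 = ≤-antisym x≤i (m<1+n⇒m≤n (subst (i <_) (+-comm x 1) i<x+1))

  coversVertical⇒ : ∀ {x y i j} → CoversCell 1 4 x y vertical i j → x ≡ i × ∃ λ d → d < 4 × y + d ≡ j
  coversVertical⇒ (x≤i , i<x+1 , y≤j , j<y+4) = within₁⇒≡ x≤i i<x+1 , within⇒offset y≤j j<y+4

  coversHorizontal⇒ : ∀ {x y i j} → CoversCell 1 4 x y horizontal i j → y ≡ j × x ≤ i × i < x + 4
  coversHorizontal⇒ (x≤i , i<x+4 , y≤j , j<y+1) = within₁⇒≡ y≤j j<y+1 , x≤i , i<x+4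

  barStart : Row → ℕ
  barStart bar0  = 0
  barStart bar1  = 1
  barStart noBar = 0

  isBarStart : Row → ℕ → Bool
  isBarStart bar0 zero          = true
  isBarStart bar1 (suc zero)    = true
  isBarStart _    _             = false

  covers⇒barStart : ∀ ℓ i → covers ℓ i ≡ true →
    isBarStart ℓ (barStart ℓ) ≡ true × barStart ℓ ≤ i × i < barStart ℓ + 4
  covers⇒barStart bar0 i       c = refl , z≤n , subst (i <_) (+-comm 4 0) (<ᵇ-true⇒< c)
  covers⇒barStart bar1 (suc i) c = refl , s≤s z≤n , s≤s (<ᵇ-true⇒< c)

  isBarStart⇒≡ : ∀ ℓ x → isBarStart ℓ x ≡ true → x ≡ barStart ℓ
  isBarStart⇒≡ bar0 zero       _ = refl
  isBarStart⇒≡ bar1 (suc zero) _ = refl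

  isBarStart⇒covers : ∀ ℓ x {i} → isBarStart ℓ x ≡ true → x ≤ i → i < x + 4 → covers ℓ i ≡ true
  isBarStart⇒covers bar0 zero       _ _ i<4           = <⇒<ᵇ-true i<4
  isBarStart⇒covers bar1 (suc zero) {suc i} _ _ (s≤s i<4) = <⇒<ᵇ-true i<4

  isBarStart⇒fits : ∀ ℓ x → isBarStart ℓ x ≡ true → x + 4 ≤ 5
  isBarStart⇒fits bar0 zero       _ = s≤s (s≤s (s≤s (s≤s z≤n)))
  isBarStart⇒fits bar1 (suc zero) _ = ≤-refl

  wordPlacement : ∀ {n} → Vec Row n → Placement
  wordPlacement w x y horizontal = isBarStart (rowAt w y) x
  wordPlacement {n} w x y vertical =
    (x <ᵇ 5) ∧ ((y <ᵇ n) ∧ (isReady (phaseAt (run start w y) x) ∧ not (covers (rowAt w y) x)))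

  module WordTiling {n} (w : Vec Row n) (accepts : Accepts start w) where

    phase : ℕ → ℕ → Phase
    phase x y = phaseAt (run start w y) x

    stepwise : AcceptsStepwise start w
    stepwise = Equivalence.to (accepts⇔stepwise start w) accepts

    phase-end : ∀ x → phase x n ≡ ph0
    phase-end x = trans (cong (λ s → phaseAt s x) (proj₂ stepwise)) (phaseAt-start x)

    covered⇒ready : ∀ {x y} → y < n → covers (rowAt w y) x ≡ true → phase x y ≡ ph0
    covered⇒ready {x} {y} y<n c = allowed⇒ready (run start w y) (rowAt w y) x (proj₁ stepwise y y<n) c

    phase-suc-covered : ∀ {x y} → x < 5 → y < n → covers (rowAt w y) x ≡ true → phase x (suc y) ≡ ph0
    phase-suc-covered {x} {y} x<5 y<n c =
      trans (phaseAt-step (run start w y) (rowAt w y) x x<5)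
            (trans (cong (λ b → if b then phase x y else advance (phase x y)) c) (covered⇒ready y<n c))

    phase-suc-uncovered : ∀ {x y} → x < 5 → covers (rowAt w y) x ≡ false → phase x (suc y) ≡ advance (phase x y)
    phase-suc-uncovered {x} {y} x<5 c =
      trans (phaseAt-step (run start w y) (rowAt w y) x x<5)
            (cong (λ b → if b then phase x y else advance (phase x y)) c)

    open-uncovered : ∀ {x y} → y < n → phase x y ≢ ph0 → covers (rowAt w y) x ≡ false
    open-uncovered {x} {y} y<n inTile with covers (rowAt w y) x in c
    ... | true  = ⊥-elim (inTile (covered⇒ready y<n c))
    ... | false = refl

    open-below-top : ∀ {x y} → y ≤ n → phase x y ≢ ph0 → y < n
    open-below-top {x} y≤n inTile with m≤n⇒m<n∨m≡n y≤n
    ... | inj₁ y<n  = y<n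
    ... | inj₂ refl = ⊥-elim (inTile (phase-end x))

    VerticalAt : ℕ → ℕ → Set
    VerticalAt x y = wordPlacement w x y vertical ≡ true

    vertical⁺ : ∀ {x y} → x < 5 → y < n → phase x y ≡ ph0 → covers (rowAt w y) x ≡ false → VerticalAt x y
    vertical⁺ x<5 y<n ready free rewrite <⇒<ᵇ-true x<5 | <⇒<ᵇ-true y<n | ready | free = refl

    vertical⁻ : ∀ {x y} → VerticalAt x y → x < 5 × y < n × phase x y ≡ ph0 × covers (rowAt w y) x ≡ false
    vertical⁻ {x} {y} v =
      <ᵇ-true⇒< (∧-conicalˡ _ _ v) ,
      <ᵇ-true⇒< (∧-conicalˡ _ _ rest) ,
      isReady⇒ph0 (∧-conicalˡ _ _ rest′) ,
      trans (sym (not-involutive _)) (cong not (∧-conicalʳ _ _ rest′))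
      where
      rest  = ∧-conicalʳ (x <ᵇ 5) _ v
      rest′ = ∧-conicalʳ (y <ᵇ n) _ rest

    vertical-run : ∀ {x y} → VerticalAt x y → ∀ d → d < 4 →
      y + d < n × covers (rowAt w (y + d)) x ≡ false × laid (phase x (y + d)) ≡ d
    vertical-run {x} {y} v zero _ rewrite +-identityʳ y with vertical⁻ {x} {y} v
    ... | _ , y<n , ready , free = y<n , free , cong laid ready
    vertical-run {x} {y} v (suc d) (s≤s d<3) with vertical-run {x} {y} v d (<⇒≤ (s≤s d<3))
    ... | y+d<n , free , laid≡d rewrite +-suc y d = next<n , open-uncovered next<n inTile , laid′
      where
      laid′ : laid (phase x (suc (y + d))) ≡ suc d
      laid′ = trans (cong laid (phase-suc-uncovered (proj₁ (vertical⁻ {x} {y} v)) free))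
                    (trans (laid-advance _ (subst (_< 3) (sym laid≡d) d<3)) (cong suc laid≡d))
      inTile : phase x (suc (y + d)) ≢ ph0
      inTile ready = 0≢1+n (trans (sym (cong laid ready)) laid′)
      next<n : suc (y + d) < n
      next<n = open-below-top {x} y+d<n inTile

    extend : ∀ {x y l} → (∃ λ y₀ → y₀ + l ≡ y × VerticalAt x y₀) → ∃ λ y₀ → y₀ + suc l ≡ suc y × VerticalAt x y₀
    extend (y₀ , e , v) = y₀ , trans (+-suc y₀ _) (cong suc e) , v

    tile-start : ∀ {x y p} → x < 5 → y ≤ n → phase x y ≡ p → p ≢ ph0 →
      ∃ λ y₀ → y₀ + laid p ≡ y × VerticalAt x y₀
    tile-start {x} {zero} _ _ ph inTile = ⊥-elim (inTile (trans (sym ph) (phaseAt-start x)))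
    tile-start {x} {suc y} x<5 y<n ph inTile with covers (rowAt w y) x in c
    ... | true = ⊥-elim (inTile (trans (sym ph) (phase-suc-covered x<5 y<n c)))
    ... | false with phase x y in ph′ | trans (sym (phase-suc-uncovered x<5 c)) ph
    ...   | ph0 | refl = y , +-comm y 1 , vertical⁺ x<5 y<n ph′ c
    ...   | ph1 | refl = extend {x} (tile-start x<5 (<⇒≤ y<n) ph′ (λ ()))
    ...   | ph2 | refl = extend {x} (tile-start x<5 (<⇒≤ y<n) ph′ (λ ()))
    ...   | ph3 | refl = ⊥-elim (inTile refl)

    vertical-below : ∀ {x y} → x < 5 → y < n → covers (rowAt w y) x ≡ false →
      ∃ λ y₀ → y₀ + laid (phase x y) ≡ y × VerticalAt x y₀
    vertical-below {x} {y} x<5 y<n free with ready? (phase x y)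
    ... | yes ready = y , trans (cong (λ p → y + laid p) ready) (+-identityʳ y) , vertical⁺ x<5 y<n ready free
    ... | no inTile = tile-start x<5 (<⇒≤ y<n) refl inTile

    fits : ∀ x y o → wordPlacement w x y o ≡ true → (x + width 1 4 o ≤ 5) × (y + height 1 4 o ≤ n)
    fits x y vertical v with vertical⁻ {x} {y} v | vertical-run {x} {y} v 3 ≤-refl
    ... | x<5 , _ | y+3<n , _ = subst (_≤ 5) (+-comm 1 x) x<5 , subst (_≤ n) (sym (+-suc y 3)) y+3<n
    fits x y horizontal h = isBarStart⇒fits (rowAt w y) x h , subst (_≤ n) (+-comm 1 y) y<n
      where
      y<n : y < n
      y<n with y <? n
      ... | yes y<n = y<n
      ... | no y≮n with trans (sym h) (cong (λ ℓ → isBarStart ℓ x) (rowAt-≥ w (≮⇒≥ y≮n)))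
      ...   | ()

    covered : ∀ i j → i < 5 → j < n → Σ ℕ λ x → Σ ℕ λ y → Σ (Fin 2) λ o →
      (wordPlacement w x y o ≡ true × CoversCell 1 4 x y o i j) ×
      (∀ x′ y′ o′ → wordPlacement w x′ y′ o′ ≡ true → CoversCell 1 4 x′ y′ o′ i j →
         (x′ ≡ x) × (y′ ≡ y) × (o′ ≡ o))
    covered i j i<5 j<n with covers (rowAt w j) i in c
    ... | true with covers⇒barStart (rowAt w j) i c
    ...   | h , start≤i , i<start+4 =
      barStart (rowAt w j) , j , horizontal , (h , start≤i , i<start+4 , ≤-refl , m<m+n j z<s) , unique
      where
      unique : ∀ x′ y′ o′ → wordPlacement w x′ y′ o′ ≡ true → CoversCell 1 4 x′ y′ o′ i j →
        (x′ ≡ barStart (rowAt w j)) × (y′ ≡ j) × (o′ ≡ horizontal)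
      unique x′ y′ vertical v cov with coversVertical⇒ cov
      ... | refl , d , d<4 , refl with vertical-run {x′} {y′} v d d<4
      ...   | _ , free , _ with trans (sym free) c
      ...     | ()
      unique x′ y′ horizontal h′ cov with coversHorizontal⇒ cov
      ... | refl , _ = isBarStart⇒≡ (rowAt w y′) x′ h′ , refl , refl
    covered i j i<5 j<n | false with vertical-below i<5 j<n c
    ... | y₀ , y₀+l≡j , v = i , y₀ , vertical , (v , ≤-refl , m<m+n i z<s , within) , unique
      where
      within : y₀ ≤ j × j < y₀ + 4
      within = offset⇒within (laid<4 (phase i j)) y₀+l≡j
      unique : ∀ x′ y′ o′ → wordPlacement w x′ y′ o′ ≡ true → CoversCell 1 4 x′ y′ o′ i j →
        (x′ ≡ i) × (y′ ≡ y₀) × (o′ ≡ vertical)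
      unique x′ y′ vertical v′ cov with coversVertical⇒ cov
      ... | refl , d , d<4 , refl with vertical-run {x′} {y′} v′ d d<4
      ...   | _ , _ , laid≡d =
        refl , +-cancelʳ-≡ d y′ y₀ (sym (trans (cong (y₀ +_) (sym laid≡d)) y₀+l≡j)) , refl
      unique x′ y′ horizontal h′ cov with coversHorizontal⇒ cov
      ... | refl , x′≤i , i<x′+4 with trans (sym (isBarStart⇒covers (rowAt w y′) x′ h′ x′≤i i<x′+4)) c
      ...   | ()

    wordPlacement-tiling : IsTilingℕ 5 n 1 4 (wordPlacement w)
    wordPlacement-tiling = fits , covered

  rowFromBars : Bool → Bool → Row
  rowFromBars true  _     = bar0
  rowFromBars false true  = bar1
  rowFromBars false false = noBar

  rowFromBars-isBarStart : ∀ ℓ → rowFromBars (isBarStart ℓ 0) (isBarStart ℓ 1) ≡ ℓ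
  rowFromBars-isBarStart bar0  = refl
  rowFromBars-isBarStart bar1  = refl
  rowFromBars-isBarStart noBar = refl

  isBarStart-≥2 : ∀ ℓ k → isBarStart ℓ (suc (suc k)) ≡ false
  isBarStart-≥2 bar0  _ = refl
  isBarStart-≥2 bar1  _ = refl
  isBarStart-≥2 noBar _ = refl

  verticalCovers : ∀ x {y₀ y} → y₀ ≤ y → y < y₀ + 4 → CoversCell 1 4 x y₀ vertical x y
  verticalCovers x y₀≤y y<y₀+4 = ≤-refl , m<m+n x z<s , y₀≤y , y<y₀+4

  module TilingWord {n} (P : Placement) (tiling : IsTilingℕ 5 n 1 4 P) where

    rowOf : ℕ → Row
    rowOf y = rowFromBars (P 0 y horizontal) (P 1 y horizontal)

    word : Vec Row n
    word = tabulateℕ n rowOf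

    phase : ℕ → ℕ → Phase
    phase x y = phaseAt (run start word y) x

    no-bar-at-≥2 : ∀ k y → P (suc (suc k)) y horizontal ≡ false
    no-bar-at-≥2 k y with P (suc (suc k)) y horizontal in h
    ... | false = refl
    ... | true with proj₁ (proj₁ tiling _ _ _ h)
    ...   | s≤s (s≤s k+4≤3) with m+n≤o⇒n≤o k k+4≤3
    ...     | s≤s (s≤s (s≤s ()))

    not-both-bars : ∀ {y} → y < n → P 0 y horizontal ≡ true → P 1 y horizontal ≡ true → ⊥
    not-both-bars {y} y<n h₀ h₁
      with covers-unique tiling (s≤s (s≤s z≤n)) y<n h₀ (z≤n , s≤s (s≤s z≤n) , ≤-refl , m<m+n y z<s)
                                              h₁ (≤-refl , s≤s (s≤s z≤n) , ≤-refl , m<m+n y z<s)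
    ... | () , _

    horizontal-rowOf : ∀ x {y} → y < n → P x y horizontal ≡ isBarStart (rowOf y) x
    horizontal-rowOf 0 {y} _ with P 0 y horizontal | P 1 y horizontal
    ... | true  | _     = refl
    ... | false | true  = refl
    ... | false | false = refl
    horizontal-rowOf 1 {y} y<n with P 0 y horizontal in h₀ | P 1 y horizontal in h₁
    ... | true  | true  = ⊥-elim (not-both-bars y<n h₀ h₁)
    ... | true  | false = refl
    ... | false | true  = refl
    ... | false | false = refl
    horizontal-rowOf (suc (suc k)) {y} _ = trans (no-bar-at-≥2 k y) (sym (isBarStart-≥2 (rowOf y) k))

    horizontal-agrees : ∀ x {y} → y < n → P x y horizontal ≡ isBarStart (rowAt word y) x
    horizontal-agrees x y<n =
      trans (horizontal-rowOf x y<n) (cong (λ ℓ → isBarStart ℓ x) (sym (rowAt-tabulateℕ n rowOf y<n)))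

    horizontal⇒covered : ∀ {x x′ y} → y < n → P x′ y horizontal ≡ true → x′ ≤ x → x < x′ + 4 →
      covers (rowAt word y) x ≡ true
    horizontal⇒covered {x′ = x′} y<n h = isBarStart⇒covers _ x′ (trans (sym (horizontal-agrees x′ y<n)) h)

    covered⇒no-vertical : ∀ {x y y₀} → x < 5 → y < n → covers (rowAt word y) x ≡ true →
      P x y₀ vertical ≡ true → y₀ ≤ y → y < y₀ + 4 → ⊥
    covered⇒no-vertical {x} {y} x<5 y<n c v y₀≤y y<y₀+4 with covers⇒barStart (rowAt word y) x c
    ... | h , start≤x , x<start+4
      with covers-unique tiling x<5 y<n
             (trans (horizontal-agrees _ y<n) h) (start≤x , x<start+4 , ≤-refl , m<m+n y z<s)
             v (verticalCovers x y₀≤y y<y₀+4)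
    ... | _ , _ , ()

    TileBelow : ℕ → ℕ → ℕ → Set
    TileBelow x y l = ∃ λ y₀ → y₀ + l ≡ y × P x y₀ vertical ≡ true

    Closed : ℕ → ℕ → Set
    Closed x y = ∀ y′ → y′ < y → P x y′ vertical ≡ true → y′ + 4 ≤ y

    PhaseInvariant : ℕ → ℕ → Phase → Set
    PhaseInvariant x y ph0 = Closed x y
    PhaseInvariant x y p   = TileBelow x y (laid p)

    Invariant : ℕ → Set
    Invariant y = ∀ x → x < 5 → PhaseInvariant x y (phase x y)

    invariant-open : ∀ {x y} p → p ≢ ph0 → PhaseInvariant x y p → TileBelow x y (laid p)
    invariant-open ph0 inTile _ = ⊥-elim (inTile refl)
    invariant-open ph1 _     t = t
    invariant-open ph2 _     t = t
    invariant-open ph3 _     t = t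

    ready-if-covered : ∀ {x y} → x < 5 → y < n → Invariant y → covers (rowAt word y) x ≡ true → phase x y ≡ ph0
    ready-if-covered {x} {y} x<5 y<n inv c with ready? (phase x y)
    ... | yes ready = ready
    ... | no inTile with invariant-open _ inTile (inv x x<5)
    ...   | y₀ , e , v = ⊥-elim (uncurry (covered⇒no-vertical x<5 y<n c v) (offset⇒within (laid<4 _) e))

    vertical-if-ready : ∀ {x y} → x < 5 → y < n → Invariant y → phase x y ≡ ph0 →
      covers (rowAt word y) x ≡ false → P x y vertical ≡ true
    vertical-if-ready {x} {y} x<5 y<n inv ready free with proj₂ tiling x y x<5 y<n
    ... | x′ , y′ , vertical , (v , x′≤x , x<x′+1 , y′≤y , y<y′+4) , _
      with within₁⇒≡ x′≤x x<x′+1 | m≤n⇒m<n∨m≡n y′≤y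
    ...   | refl | inj₂ refl = v
    ...   | refl | inj₁ y′<y = ⊥-elim (<-irrefl refl (<-≤-trans y<y′+4 (closed y′ y′<y v)))
      where
      closed : Closed x y
      closed = subst (PhaseInvariant x y) ready (inv x x<5)
    vertical-if-ready {x} {y} x<5 y<n inv ready free | x′ , y′ , horizontal , (h , cov) , _
      with coversHorizontal⇒ cov
    ... | refl , x′≤x , x<x′+4 with trans (sym (horizontal⇒covered y<n h x′≤x x<x′+4)) free
    ...   | ()

    no-vertical-if-open : ∀ {x y} → x < 5 → y < n → Invariant y → phase x y ≢ ph0 → P x y vertical ≡ false
    no-vertical-if-open {x} {y} x<5 y<n inv inTile with P x y vertical in v
    ... | false = refl
    ... | true with invariant-open _ inTile (inv x x<5)
    ...   | y₀ , e , v₀ with uncurry (verticalCovers x) (offset⇒within (laid<4 _) e)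
    ...     | cov₀ with covers-unique tiling x<5 y<n v (verticalCovers x ≤-refl (m<m+n y z<s)) v₀ cov₀
    ...       | _ , refl , _ = ⊥-elim (inTile (laid≡0⇒ph0 (+-cancelˡ-≡ y _ 0 (trans e (sym (+-identityʳ y))))))

    vertical-agrees : ∀ {x y} → x < 5 → y < n → Invariant y → P x y vertical ≡ wordPlacement word x y vertical
    vertical-agrees {x} {y} x<5 y<n inv rewrite <⇒<ᵇ-true x<5 | <⇒<ᵇ-true y<n with phase x y in ph
    ... | ph1 = no-vertical-if-open x<5 y<n inv (subst (_≢ ph0) (sym ph) λ ())
    ... | ph2 = no-vertical-if-open x<5 y<n inv (subst (_≢ ph0) (sym ph) λ ())
    ... | ph3 = no-vertical-if-open x<5 y<n inv (subst (_≢ ph0) (sym ph) λ ())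
    ... | ph0 with covers (rowAt word y) x in c
    ...   | false = vertical-if-ready x<5 y<n inv ph c
    ...   | true with P x y vertical in v
    ...     | false = refl
    ...     | true  = ⊥-elim (covered⇒no-vertical x<5 y<n c v ≤-refl (m<m+n y z<s))

    invariant-step : ∀ {y} → y < n → Invariant y → Invariant (suc y)
    invariant-step {y} y<n inv x x<5 =
      subst (PhaseInvariant x (suc y)) (sym (phaseAt-step (run start word y) (rowAt word y) x x<5)) next
      where
      extend : ∀ {l} → TileBelow x y l → TileBelow x (suc y) (suc l)
      extend (y₀ , e , v) = y₀ , trans (+-suc y₀ _) (cong suc e) , v
      next : PhaseInvariant x (suc y) (if covers (rowAt word y) x then phase x y else advance (phase x y))
      next with covers (rowAt word y) x in c
      ... | true = subst (PhaseInvariant x (suc y)) (sym ready) closed′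
        where
        ready : phase x y ≡ ph0
        ready = ready-if-covered x<5 y<n inv c
        closed′ : Closed x (suc y)
        closed′ y′ y′<1+y v with m≤n⇒m<n∨m≡n (m<1+n⇒m≤n y′<1+y)
        ... | inj₁ y′<y = ≤-trans (subst (PhaseInvariant x y) ready (inv x x<5) y′ y′<y v) (n≤1+n y)
        ... | inj₂ refl = ⊥-elim (covered⇒no-vertical x<5 y<n c v ≤-refl (m<m+n y z<s))
      ... | false with phase x y in ph | inv x x<5
      ...   | ph0 | _ = y , +-comm y 1 , vertical-if-ready x<5 y<n inv ph c
      ...   | ph1 | t = extend t
      ...   | ph2 | t = extend t
      ...   | ph3 | y₀ , e , v₀ = closed′
        where
        closed′ : Closed x (suc y)
        closed′ y′ y′<1+y v with y′ + 4 ≤? suc y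
        ... | yes fits = fits
        ... | no 1+y≮y′+4 with offset⇒within {d = 3} ≤-refl e
        ...   | y₀≤y , y<y₀+4
          with covers-unique tiling x<5 y<n
                 v (verticalCovers x (m<1+n⇒m≤n y′<1+y) (<-trans (n<1+n y) (≰⇒> 1+y≮y′+4)))
                 v₀ (verticalCovers x y₀≤y y<y₀+4)
        ...     | _ , refl , _ = subst (y′ + 4 ≤_) (trans (+-suc y′ 3) (cong suc e)) ≤-refl

    invariant : ∀ y → y ≤ n → Invariant y
    invariant zero    _   x _ = subst (PhaseInvariant x 0) (sym (phaseAt-start x)) λ _ ()
    invariant (suc y) y<n     = invariant-step y<n (invariant y (<⇒≤ y<n))

    ready-at-top : ∀ x → x < 5 → phase x n ≡ ph0
    ready-at-top x x<5 with ready? (phase x n)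
    ... | yes ready = ready
    ... | no inTile with invariant-open _ inTile (invariant n ≤-refl x x<5)
    ...   | y₀ , e , v = ⊥-elim (<-irrefl refl (<-≤-trans n<y₀+4 (proj₂ (proj₁ tiling x y₀ vertical v))))
      where
      n<y₀+4 : n < y₀ + 4
      n<y₀+4 = proj₂ (offset⇒within (laid<4 _) e)

    word-accepts : Accepts start word
    word-accepts =
      Equivalence.from (accepts⇔stepwise start word) (allowed-everywhere , ready⇒start _ ready-at-top)
      where
      allowed-everywhere : ∀ y → y < n → allowed (run start word y) (rowAt word y) ≡ true
      allowed-everywhere y y<n = ready⇒allowed (run start word y) (rowAt word y)
        (λ x x<5 c → ready-if-covered x<5 y<n (invariant y (<⇒≤ y<n)) c)

    placement-agrees : ∀ x y o → x < 5 → y < n → P x y o ≡ wordPlacement word x y o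
    placement-agrees x y vertical   x<5 y<n = vertical-agrees x<5 y<n (invariant y (<⇒≤ y<n))
    placement-agrees x y horizontal _   y<n = horizontal-agrees x y<n

  toPlacement-fromPlacement : ∀ {m n} (P : Placement) {x y} o → x < m → y < n →
    toPlacement (fromPlacement {m} {n} P) x y o ≡ P x y o
  toPlacement-fromPlacement P o x<m y<n with asFin x<m | asFin y<n
  ... | x , refl | y , refl = trans (toPlacement-toℕ (fromPlacement P) x y o) (lookup-fromPlacement P x y o)

  encode : ∀ {n} → Vec Row n → TileSet 5 n
  encode w = fromPlacement (wordPlacement w)

  decode : ∀ {n} → TileSet 5 n → Vec Row n
  decode {n} S = tabulateℕ n λ y → rowFromBars (toPlacement S 0 y horizontal) (toPlacement S 1 y horizontal)

  decode-encode : ∀ {n} (w : Vec Row n) → decode (encode w) ≡ w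
  decode-encode {n} w = tabulateℕ-rowAt n _ w λ y y<n →
    trans (cong₂ rowFromBars (toPlacement-fromPlacement {5} (wordPlacement w) horizontal (s≤s z≤n) y<n)
                             (toPlacement-fromPlacement {5} (wordPlacement w) horizontal (s≤s (s≤s z≤n)) y<n))
          (rowFromBars-isBarStart (rowAt w y))

  tilings : (n : ℕ) → List (TileSet 5 n)
  tilings n = map encode (accepted n start)

  tiling⇒encoded : ∀ {n} (S : TileSet 5 n) → IsTiling 5 n 1 4 S → S ≡ encode (decode S)
  tiling⇒encoded S tiling =
    trans (sym (fromPlacement-toPlacement S)) (fromPlacement-cong (TilingWord.placement-agrees _ tilingℕ))
    where tilingℕ = IsTiling⇒IsTilingℕ S tiling

  countTilings : ∀ n → NumTilings 5 n 1 4 (count n start)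
  countTilings n =
    tilings n , unique , sound , complete ,
    trans (length-map encode (accepted n start)) (length-accepted n start)
    where
    unique : Unique (tilings n)
    unique = Unique.map⁺ (λ e → trans (sym (decode-encode _)) (trans (cong decode e) (decode-encode _)))
                         (accepted-unique n start)
    sound : ∀ S → S ∈ tilings n → IsTiling 5 n 1 4 S
    sound S m with ∈-map⁻ encode m
    ... | w , m′ , refl =
      IsTilingℕ⇒IsTiling (wordPlacement w) (WordTiling.wordPlacement-tiling w (∈-accepted⁻ n start m′))
    complete : ∀ S → IsTiling 5 n 1 4 S → S ∈ tilings n
    complete S tiling = subst (_∈ tilings n) (sym (tiling⇒encoded S tiling))
      (∈-map⁺ encode (∈-accepted⁺ start (decode S) (TilingWord.word-accepts _ (IsTiling⇒IsTilingℕ S tiling))))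

module PowerSeries where

  open LinearRecurrence using (Annihilated; annihilated; Recurrence)
  open import Data.Nat as ℕ using (ℕ; zero; suc)
  open import Data.Integer as ℤ using (ℤ; +_; 0ℤ; _+_; _*_; -_; _-_)
  import Data.Integer.Properties as ℤ
  open import Data.Integer.Solver using (module +-*-Solver)
  open import Algebra.Properties.CommutativeSemigroup ℤ.+-commutativeSemigroup using (interchange)
  open import Relation.Binary.PropositionalEquality
    using (_≡_; refl; sym; trans; cong; cong₂; module ≡-Reasoning)

  shift : ℕ → Series → Series
  shift zero    f n       = f n
  shift (suc k) f zero    = 0ℤ
  shift (suc k) f (suc n) = shift k f n

  convolve-cong : ∀ {F G} → (∀ i j → F i j ≡ G i j) → ∀ n → convolve F n ≡ convolve G n
  convolve-cong F≡G zero    = F≡G 0 0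
  convolve-cong F≡G (suc n) = cong₂ _+_ (F≡G 0 (suc n)) (convolve-cong (λ i → F≡G (suc i)) n)

  convolve-+ : ∀ F G n → convolve (λ i j → F i j + G i j) n ≡ convolve F n + convolve G n
  convolve-+ F G zero    = refl
  convolve-+ F G (suc n) = begin
    (F 0 (suc n) + G 0 (suc n)) + convolve (λ i j → F (suc i) j + G (suc i) j) n
      ≡⟨ cong (_+_ (F 0 (suc n) + G 0 (suc n))) (convolve-+ (λ i → F (suc i)) (λ i → G (suc i)) n) ⟩
    (F 0 (suc n) + G 0 (suc n)) + (convolve (λ i → F (suc i)) n + convolve (λ i → G (suc i)) n)
      ≡⟨ interchange (F 0 (suc n)) (G 0 (suc n)) _ _ ⟩
    (F 0 (suc n) + convolve (λ i → F (suc i)) n) + (G 0 (suc n) + convolve (λ i → G (suc i)) n) ∎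
    where open ≡-Reasoning

  convolve-neg : ∀ F n → convolve (λ i j → - F i j) n ≡ - convolve F n
  convolve-neg F zero    = refl
  convolve-neg F (suc n) =
    trans (cong (_+_ (- F 0 (suc n))) (convolve-neg (λ i → F (suc i)) n))
          (sym (ℤ.neg-distrib-+ (F 0 (suc n)) (convolve (λ i → F (suc i)) n)))

  convolve-scale : ∀ c F n → convolve (λ i j → c * F i j) n ≡ c * convolve F n
  convolve-scale c F zero    = refl
  convolve-scale c F (suc n) =
    trans (cong (_+_ (c * F 0 (suc n))) (convolve-scale c (λ i → F (suc i)) n))
          (sym (ℤ.*-distribˡ-+ c (F 0 (suc n)) (convolve (λ i → F (suc i)) n)))

  ⊛-congˡ : ∀ {f f′} g → f ≈ₛ f′ → (f ⊛ g) ≈ₛ (f′ ⊛ g)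
  ⊛-congˡ g f≈f′ = convolve-cong (λ i j → cong (_* g j) (f≈f′ i))

  ⊛-distribˡ-⊕ : ∀ f g h n → (f ⊛ (g ⊕ h)) n ≡ (f ⊛ g) n + (f ⊛ h) n
  ⊛-distribˡ-⊕ f g h n =
    trans (convolve-cong (λ i j → ℤ.*-distribˡ-+ (f i) (g j) (h j)) n)
          (convolve-+ (λ i j → f i * g j) (λ i j → f i * h j) n)

  ⊛-distribˡ-⊖ : ∀ f g h n → (f ⊛ (g ⊖ h)) n ≡ (f ⊛ g) n - (f ⊛ h) n
  ⊛-distribˡ-⊖ f g h n =
    trans (convolve-cong distrib n)
          (trans (convolve-+ (λ i j → f i * g j) (λ i j → - (f i * h j)) n)
                 (cong (_+_ ((f ⊛ g) n)) (convolve-neg (λ i j → f i * h j) n)))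
    where
    distrib : ∀ i j → f i * (g j - h j) ≡ f i * g j + - (f i * h j)
    distrib i j = trans (ℤ.*-distribˡ-+ (f i) (g j) (- h j))
                        (cong (_+_ (f i * g j)) (sym (ℤ.neg-distribʳ-* (f i) (h j))))

  ⊛-· : ∀ f c g n → (f ⊛ (c · g)) n ≡ c * (f ⊛ g) n
  ⊛-· f c g n =
    trans (convolve-cong (λ i j → solve 3 (λ a b d → a :* (b :* d) := b :* (a :* d)) refl (f i) c (g j)) n)
          (convolve-scale c (λ i j → f i * g j) n)
    where open +-*-Solver

  shift-split : ∀ k f n → shift k f n ≡ f 0 * zpow k n + shift (suc k) (λ i → f (suc i)) n
  shift-split zero    f zero    = sym (trans (ℤ.+-identityʳ (f 0 * + 1)) (ℤ.*-identityʳ (f 0)))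
  shift-split zero    f (suc n) =
    sym (trans (cong (_+ f (suc n)) (ℤ.*-zeroʳ (f 0))) (ℤ.+-identityˡ (f (suc n))))
  shift-split (suc k) f zero    = sym (trans (ℤ.+-identityʳ (f 0 * 0ℤ)) (ℤ.*-zeroʳ (f 0)))
  shift-split (suc k) f (suc n) = shift-split k f n

  ⊛-zpow : ∀ f k n → (f ⊛ zpow k) n ≡ shift k f n
  ⊛-zpow f zero    zero    = ℤ.*-identityʳ (f 0)
  ⊛-zpow f (suc k) zero    = ℤ.*-zeroʳ (f 0)
  ⊛-zpow f zero    (suc n) =
    trans (cong₂ _+_ (ℤ.*-zeroʳ (f 0)) (⊛-zpow (λ i → f (suc i)) zero n)) (ℤ.+-identityˡ _)
  ⊛-zpow f (suc k) (suc n) =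
    trans (cong (_+_ (f 0 * zpow k n)) (⊛-zpow (λ i → f (suc i)) (suc k) n)) (sym (shift-split k f n))

  denominator numerator : Series
  denominator = ((((one ⊖ ((+ 6) · zpow 5)) ⊕ ((+ 6) · zpow 10)) ⊖ ((+ 4) · zpow 15)) ⊕ zpow 20)
  numerator   = ((one ⊖ zpow 5) ⊛ (one ⊖ zpow 5)) ⊛ (one ⊖ zpow 5)

  denominatorCombination : Series → Series
  denominatorCombination A n =
    (((A n - + 6 * shift 5 A n) + + 6 * shift 10 A n) - + 4 * shift 15 A n) + shift 20 A n

  ⊛-denominator : ∀ A n → (A ⊛ denominator) n ≡ denominatorCombination A n
  ⊛-denominator A n =
    trans (⊛-distribˡ-⊕ A _ (zpow 20) n) (cong₂ _+_
      (trans (⊛-distribˡ-⊖ A _ _ n) (cong₂ _-_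
        (trans (⊛-distribˡ-⊕ A _ _ n) (cong₂ _+_
          (trans (⊛-distribˡ-⊖ A _ _ n) (cong₂ _-_ (⊛-zpow A 0 n) (scaled 6 5)))
          (scaled 6 10)))
        (scaled 4 15)))
      (⊛-zpow A 20 n))
    where
    scaled : ∀ c k → (A ⊛ ((+ c) · zpow k)) n ≡ + c * shift k A n
    scaled c k = trans (⊛-· A (+ c) (zpow k) n) (cong (_*_ (+ c)) (⊛-zpow A k n))

  ⊛-one⊖zpow : ∀ k F n → (F ⊛ (one ⊖ zpow k)) n ≡ F n - shift k F n
  ⊛-one⊖zpow k F n = trans (⊛-distribˡ-⊖ F one (zpow k) n) (cong₂ _-_ (⊛-zpow F 0 n) (⊛-zpow F k n))

  numerator-vanishes : ∀ m → numerator (20 ℕ.+ m) ≡ 0ℤ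
  numerator-vanishes m =
    trans (⊛-one⊖zpow 5 (g ⊛ g) (20 ℕ.+ m))
          (cong₂ _-_ (⊛-one⊖zpow 5 g (20 ℕ.+ m)) (⊛-one⊖zpow 5 g (15 ℕ.+ m)))
    where
    g : Series
    g = one ⊖ zpow 5

  Annihilated⇒ℤ : ∀ {u₀ u₁ u₂ u₃ u₄} → Annihilated u₀ u₁ u₂ u₃ u₄ →
    (((+ u₄ - + 6 * + u₃) + + 6 * + u₂) - + 4 * + u₁) + + u₀ ≡ 0ℤ
  Annihilated⇒ℤ {u₀} {u₁} {u₂} {u₃} {u₄} (annihilated eq) = begin
    (((+ u₄ - + 6 * + u₃) + + 6 * + u₂) - + 4 * + u₁) + + u₀
      ≡⟨ regroup (+ u₀) (+ u₁) (+ u₂) (+ u₃) (+ u₄) ⟩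
    (+ u₄ + + 6 * + u₂ + + u₀) - (+ 6 * + u₃ + + 4 * + u₁)
      ≡⟨ cong₂ _-_ (sym (cast-lhs)) (sym cast-rhs) ⟩
    + (u₄ ℕ.+ 6 ℕ.* u₂ ℕ.+ u₀) - + (6 ℕ.* u₃ ℕ.+ 4 ℕ.* u₁)
      ≡⟨ cong (λ x → + x - + (6 ℕ.* u₃ ℕ.+ 4 ℕ.* u₁)) eq ⟩
    + (6 ℕ.* u₃ ℕ.+ 4 ℕ.* u₁) - + (6 ℕ.* u₃ ℕ.+ 4 ℕ.* u₁)
      ≡⟨ ℤ.+-inverseʳ (+ (6 ℕ.* u₃ ℕ.+ 4 ℕ.* u₁)) ⟩
    0ℤ ∎
    where
    open ≡-Reasoning
    open +-*-Solver
    regroup = solve 5 (λ u₀ u₁ u₂ u₃ u₄ →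
                (((u₄ :- con (+ 6) :* u₃) :+ con (+ 6) :* u₂) :- con (+ 4) :* u₁) :+ u₀
                := (u₄ :+ con (+ 6) :* u₂ :+ u₀) :- (con (+ 6) :* u₃ :+ con (+ 4) :* u₁)) refl
    cast-lhs : + (u₄ ℕ.+ 6 ℕ.* u₂ ℕ.+ u₀) ≡ + u₄ + + 6 * + u₂ + + u₀
    cast-lhs = trans (ℤ.pos-+ (u₄ ℕ.+ 6 ℕ.* u₂) u₀)
                     (cong (_+ + u₀) (trans (ℤ.pos-+ u₄ (6 ℕ.* u₂)) (cong (_+_ (+ u₄)) (ℤ.pos-* 6 u₂))))
    cast-rhs : + (6 ℕ.* u₃ ℕ.+ 4 ℕ.* u₁) ≡ + 6 * + u₃ + + 4 * + u₁
    cast-rhs = trans (ℤ.pos-+ (6 ℕ.* u₃) (4 ℕ.* u₁)) (cong₂ _+_ (ℤ.pos-* 6 u₃) (ℤ.pos-* 4 u₁))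

  denominator-annihilates : ∀ {a} → Recurrence 5 a → ∀ m → (genSeries a ⊛ denominator) (20 ℕ.+ m) ≡ 0ℤ
  denominator-annihilates {a} r m = trans (⊛-denominator (genSeries a) (20 ℕ.+ m)) (Annihilated⇒ℤ (r m))

open LinearRecurrence
  using (Recurrence; recurrence-subsample; stretch; stretch-*5; stretch-∤; stretch-recurrence)
open TransferMatrix using (count; start; count-recurrence)
open Tilings using (countTilings)
open PowerSeries
open import Data.Nat using (ℕ; zero; suc; _*_; _≤?_)
open import Data.Nat.Properties using (*-comm; ≰⇒>; m≤n⇒∃[o]m+o≡n)
open import Data.Nat.Divisibility using (_∣?_; divides)
open import Data.Integer as ℤ using (ℤ; +_)
import Data.Integer.Properties as ℤ
open import Data.List using (upTo)
open import Data.List.Membership.Propositional.Properties using (∈-upTo⁺)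
open import Data.List.Membership.Propositional.Properties.WithK using (unique∧set⇒bag)
open import Data.List.Relation.Binary.BagAndSetEquality using (∼bag⇒↭)
open import Data.List.Relation.Binary.Permutation.Propositional.Properties using (↭-length)
open import Data.List.Relation.Unary.All as All using (All)
open import Data.Product using (Σ; _×_; _,_; proj₁)
open import Function using (mk⇔)
open import Relation.Nullary using (yes; no)
open import Relation.Nullary.Decidable using (from-yes)
open import Relation.Binary.PropositionalEquality using (_≡_; refl; sym; trans; cong; subst)

HasCount-unique : {A : Set} {P : A → Set} {k₁ k₂ : ℕ} → HasCount P k₁ → HasCount P k₂ → k₁ ≡ k₂
HasCount-unique (_ , unique₁ , sound₁ , complete₁ , refl) (_ , unique₂ , sound₂ , complete₂ , refl) =
  ↭-length (∼bag⇒↭ (unique∧set⇒bag unique₁ unique₂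
    (mk⇔ (λ m → complete₂ _ (sound₁ _ m)) (λ m → complete₁ _ (sound₂ _ m)))))

tilingCounts : ℕ → ℕ
tilingCounts q = count (q * 4) start

tilingCounts-recurrence : Recurrence 1 tilingCounts
tilingCounts-recurrence = recurrence-subsample {f = λ n → count n start} (count-recurrence start)

tilingSequence : ℕ → ℕ
tilingSequence = stretch tilingCounts

tilingSequence-recurrence : Recurrence 5 tilingSequence
tilingSequence-recurrence = stretch-recurrence tilingCounts-recurrence

generating-identity : (genSeries tilingSequence ⊛ denominator) ≈ₛ numerator
generating-identity n with 20 ≤? n
... | yes 20≤n = let m , 20+m≡n = m≤n⇒∃[o]m+o≡n 20≤n in
  subst (λ k → (genSeries tilingSequence ⊛ denominator) k ≡ numerator k) 20+m≡n
        (trans (denominator-annihilates tilingSequence-recurrence m) (sym (numerator-vanishes m)))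
... | no 20≰n = All.lookup initial (∈-upTo⁺ (≰⇒> 20≰n))
  where
  initial : All (λ k → (genSeries tilingSequence ⊛ denominator) k ≡ numerator k) (upTo 20)
  initial = from-yes (All.all? (λ k → (genSeries tilingSequence ⊛ denominator) k ℤ.≟ numerator k) (upTo 20))

tilingSequence-5* : ∀ k → tilingSequence (5 * suc k) ≡ count (4 * suc k) start
tilingSequence-5* k = trans (cong tilingSequence (*-comm 5 (suc k)))
                      (trans (stretch-*5 tilingCounts (suc k)) (cong (λ m → count m start) (*-comm (suc k) 4)))

tilingSequence-IsSeqA : IsSeqA tilingSequence
tilingSequence-IsSeqA =
  refl , stretch-∤ tilingCounts ,
  λ k → subst (NumTilings 5 (4 * suc k) 1 4) (sym (tilingSequence-5* k)) (countTilings (4 * suc k))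

IsSeqA-unique : ∀ a → IsSeqA a → ∀ N → a N ≡ tilingSequence N
IsSeqA-unique a (a₀ , a∤ , a-tilings) N with 5 ∣? N
... | no 5∤N                    = trans (a∤ N 5∤N) (sym (stretch-∤ tilingCounts N 5∤N))
... | yes (divides zero refl)    = a₀
... | yes (divides (suc k) refl) =
  trans (cong a (*-comm (suc k) 5))
        (trans (HasCount-unique (a-tilings k) (countTilings (4 * suc k)))
               (trans (sym (tilingSequence-5* k)) (cong tilingSequence (*-comm 5 (suc k)))))

mainTheorem4 :
    Σ (ℕ → ℕ) IsSeqA ×
    (∀ (a : ℕ → ℕ) → IsSeqA a →
      ((genSeries a ⊛ (((((one ⊖ ((+ 6) · zpow 5)) ⊕ ((+ 6) · zpow 10)) ⊖ ((+ 4) · zpow 15)) ⊕ zpow 20)))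
         ≈ₛ (((one ⊖ zpow 5) ⊛ (one ⊖ zpow 5)) ⊛ (one ⊖ zpow 5)))
      × (a 0 ≡ 1) × (a 5 ≡ 3) × (a 10 ≡ 15) × (a 15 ≡ 75) × (a 20 ≡ 371))
mainTheorem4 = (tilingSequence , tilingSequence-IsSeqA) , λ a isSeqA →
  let a≡ = IsSeqA-unique a isSeqA in
  (λ n → trans (⊛-congˡ denominator (λ N → cong +_ (a≡ N)) n) (generating-identity n)) ,
  proj₁ isSeqA , a≡ 5 , a≡ 10 , a≡ 15 , a≡ 20
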